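{- Let $p$ be a prime with $p\equiv 7 \pmod{12}$. For each primitive 6th root of unity $u\in\mathbb{Z}_p$, there is a simple rank $3$ matroid structure on $\mathbb{Z}_p$, invariant under translation by elements of $\mathbb{Z}_p$, such that a $3$-element subset of $\mathbb{Z}_p$ is a basis unless it is of the form $\{x,\,x+\alpha^2,\,x+u\alpha^2\}$ for some $x\in\mathbb{Z}_p$ and $\alpha\in\mathbb{Z}_p^\times$.
   Context: A matroid is simple if every circuit has at least three elements. -}

module Defs where

open import Level using (0ℓ)
open import Data.Nat using (ℕ; zero; suc; _≤_; _<_; NonZero)
open import Data.Fin using (Fin; toℕ)
open import Data.Fin.Subset using (Subset; _∈_; _∉_; _⊆_; _∪_; _-_; ⁅_⁆; ∣_∣; ⊥)
open import Data.Nat.DivMod using (_mod_)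
open import Data.Product using (Σ; _×_; ∃-syntax)
open import Data.Vec using (tabulate; lookup)
open import Relation.Nullary using (¬_)
open import Relation.Binary.PropositionalEquality using (_≡_; _≢_)
import Data.Nat as ℕ

record Matroid (n : ℕ) : Set₁ where
  field
    Indep        : Subset n → Set
    indep-empty  : Indep ⊥
    indep-subset : ∀ {A B} → A ⊆ B → Indep B → Indep A
    indep-augment : ∀ {A B} → Indep A → Indep B → ∣ A ∣ < ∣ B ∣ →
                    ∃[ x ] (x ∈ B × x ∉ A × Indep (A ∪ ⁅ x ⁆))

module _ {n : ℕ} (M : Matroid n) where
  open Matroid M

  IsBasis : Subset n → Set
  IsBasis B = Indep B × (∀ x → x ∉ B → ¬ Indep (B ∪ ⁅ x ⁆))

  IsCircuit : Subset n → Set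
  IsCircuit C = ¬ Indep C × (∀ x → x ∈ C → Indep (C - x))

  Simple : Set
  Simple = ∀ C → IsCircuit C → 3 ≤ ∣ C ∣

  HasRank : ℕ → Set
  HasRank r = (∃[ B ] (Indep B × ∣ B ∣ ≡ r)) × (∀ A → Indep A → ∣ A ∣ ≤ r)

module _ {p : ℕ} .{{_ : NonZero p}} where
  infixl 6 _+ₚ_ _-ₚ_
  infixl 7 _*ₚ_

  0ₚ : Fin p
  0ₚ = 0 mod p

  1ₚ : Fin p
  1ₚ = 1 mod p

  _+ₚ_ : Fin p → Fin p → Fin p
  x +ₚ y = (toℕ x ℕ.+ toℕ y) mod p

  _*ₚ_ : Fin p → Fin p → Fin p
  x *ₚ y = (toℕ x ℕ.* toℕ y) mod p

  -ₚ_ : Fin p → Fin p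
  -ₚ x = (p ℕ.∸ toℕ x) mod p

  _-ₚ_ : Fin p → Fin p → Fin p
  x -ₚ y = x +ₚ (-ₚ y)

  _^ₚ_ : Fin p → ℕ → Fin p
  x ^ₚ zero  = 1ₚ
  x ^ₚ suc k = x *ₚ (x ^ₚ k)

  PrimitiveSixthRoot : Fin p → Set
  PrimitiveSixthRoot u = (u ^ₚ 6 ≡ 1ₚ) × (∀ k → 1 ≤ k → k < 6 → u ^ₚ k ≢ 1ₚ)

  -- translate a subset A by t : the set {t + a | a ∈ A}
  translate : Fin p → Subset p → Subset p
  translate t A = tabulate (λ y → lookup A (y -ₚ t))

  TranslationInvariant : Matroid p → Set
  TranslationInvariant M =
    ∀ t A → (Matroid.Indep M A → Matroid.Indep M (translate t A))
          × (Matroid.Indep M (translate t A) → Matroid.Indep M A)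

  SpecialTriple : Fin p → Subset p → Set
  SpecialTriple u B =
    ∃[ x ] ∃[ α ] (α ≢ 0ₚ ×
      B ≡ ⁅ x ⁆ ∪ ⁅ x +ₚ α *ₚ α ⁆ ∪ ⁅ x +ₚ u *ₚ (α *ₚ α) ⁆)

{-# OPTIONS --safe #-}
module Submission where

-- Call the sets {x, x + α², x + u α²} (α ≠ 0) lines. Because u² + 1 = u and u³ = -1, the line
-- with base point x and parameter α is also the line with base point x + α² and parameter u α,
-- so a line can be based at any of its points. Two lines through a ≠ b, both based at a, then
-- have parameters with α² = β² (the same line) or α² = u β², which is impossible: u is a
-- quadratic non-residue, as u^((p-1)/2) = u³ ≠ 1 when p ≡ 7 (mod 12). So two points lie on at
-- most one line, and then the sets of size ≤ 2 together with the 3-sets that are not lines are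
-- the independent sets of a simple rank-3 matroid whose bases are exactly the non-lines.
-- Translations permute the lines, hence preserve the matroid.

open import Defs
open import Level using (0ℓ)
open import Data.Nat as ℕ using (ℕ; zero; suc; NonZero; _%_; _≤_; _<_; _≤?_; s≤s; z≤n)
import Data.Nat.Properties as ℕ
open import Data.Nat.DivMod
  using (_mod_; _/_; m≡m%n+[m/n]*n; m%n<n; %-distribˡ-+; %-distribˡ-*; m<n⇒m%n≡m; m%n≤m; n%n≡0)
open import Data.Nat.Divisibility using (_∣_; n∣m⇒m%n≡0; m%n≡0⇒n∣m)
open import Data.Nat.Primality using (Prime; euclidsLemma; prime⇒nonTrivial)
open import Data.Nat.Tactic.RingSolver using (solve-∀)
open import Data.Fin as Fin using (Fin; toℕ; punchOut)
open import Data.Fin.Properties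
  using (any?; _≟_; toℕ-fromℕ<; toℕ-injective; toℕ<n; punchOut-injective; injective⇒≤; inject≤-injective)
open import Data.Fin.Patterns using (0F; 1F; 2F; 3F)
open import Data.Fin.Permutation using (Permutation; permutation; _⟨$⟩ʳ_)
open import Data.Fin.Subset using (Subset; ⊥; _∈_; _∉_; _⊆_; _∪_; ⁅_⁆; ∣_∣; inside; outside)
open import Data.Fin.Subset.Properties
  using (_∈?_; ⊆-antisym; p⊆q⇒∣p∣≤∣q∣; p⊂q⇒∣p∣<∣q∣; ∪-comm; ∪-identityˡ; ∣⊥∣≡0; ∣⁅x⁆∣≡1;
         x∈⁅x⁆; x∈⁅y⁆⇒x≡y; x∈p∪q⁻; x∈p∪q⁺; p⊆p∪q)
open import Data.Vec using ([]; _∷_; here; there; tabulate; lookup)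
open import Data.Vec.Properties
  using (lookup∘tabulate; tabulate∘lookup; tabulate-cong; []=⇒lookup; lookup⇒[]=; ≡-dec)
open import Data.Bool using (Bool; if_then_else_)
import Data.Bool.Properties as Bool
open import Data.Product using (_×_; _,_; ∃-syntax; ∃₂; proj₁; proj₂)
open import Data.Empty using (⊥-elim)
open import Data.Sum as Sum using (_⊎_; inj₁; inj₂; [_,_]′)
open import Function using (_∘_; id; _⇔_; mk⇔)
open import Function.Definitions using (Injective)
open import Relation.Nullary using (¬_; yes; no; ¬?; _×-dec_; contradiction)
open import Relation.Nullary.Decidable using (decidable-stable)
open import Relation.Unary using (Decidable)
open import Relation.Binary.PropositionalEquality
open import Algebra.Bundles using (CommutativeRing)
open import Algebra.Consequences.Propositional using (comm∧idˡ⇒id; comm∧invˡ⇒inv; comm∧distrˡ⇒distr)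
import Algebra.Properties.CommutativeMonoid.Sum as MonoidSum
open ≡-Reasoning

-- Finite sets

injective⇒surjective : ∀ {n} {f : Fin n → Fin n} → Injective _≡_ _≡_ f → ∀ y → ∃[ x ] f x ≡ y
injective⇒surjective {suc n} {f} f-injective y with any? (λ x → f x ≟ y)
... | yes found = found
... | no  none  = contradiction (injective⇒≤ {f = g} g-injective) ℕ.1+n≰n
  where
  y≢f : ∀ x → y ≢ f x
  y≢f x y≡fx = none (x , sym y≡fx)

  g : Fin (suc n) → Fin n
  g x = punchOut (y≢f x)

  g-injective : Injective _≡_ _≡_ g
  g-injective {x} {x′} gx≡gx′ = f-injective (punchOut-injective (y≢f x) (y≢f x′) gx≡gx′)

∣⁅x⁆∪p∣≡1+∣p∣ : ∀ {n} {x : Fin n} (p : Subset n) → x ∉ p → ∣ ⁅ x ⁆ ∪ p ∣ ≡ suc ∣ p ∣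
∣⁅x⁆∪p∣≡1+∣p∣ {x = Fin.zero}  (inside  ∷ p) x∉p = contradiction here x∉p
∣⁅x⁆∪p∣≡1+∣p∣ {x = Fin.zero}  (outside ∷ p) _   = cong (suc ∘ ∣_∣) (∪-identityˡ p)
∣⁅x⁆∪p∣≡1+∣p∣ {x = Fin.suc x} (inside  ∷ p) x∉p = cong suc (∣⁅x⁆∪p∣≡1+∣p∣ p (x∉p ∘ there))
∣⁅x⁆∪p∣≡1+∣p∣ {x = Fin.suc x} (outside ∷ p) x∉p = ∣⁅x⁆∪p∣≡1+∣p∣ p (x∉p ∘ there)

∣p∪⁅x⁆∣≡1+∣p∣ : ∀ {n} {x : Fin n} (p : Subset n) → x ∉ p → ∣ p ∪ ⁅ x ⁆ ∣ ≡ suc ∣ p ∣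
∣p∪⁅x⁆∣≡1+∣p∣ {x = x} p x∉p = trans (cong ∣_∣ (∪-comm p ⁅ x ⁆)) (∣⁅x⁆∪p∣≡1+∣p∣ p x∉p)

⊆⊎∃∈∖ : ∀ {n} (p q : Subset n) → q ⊆ p ⊎ ∃[ x ] (x ∈ q × x ∉ p)
⊆⊎∃∈∖ p q with any? (λ x → x ∈? q ×-dec ¬? (x ∈? p))
... | yes found = inj₂ found
... | no  none  = inj₁ (λ {x} x∈q → decidable-stable (x ∈? p) (λ x∉p → none (x , x∈q , x∉p)))

∣p∣<∣q∣⇒∃∈q∖p : ∀ {n} {p q : Subset n} → ∣ p ∣ < ∣ q ∣ → ∃[ x ] (x ∈ q × x ∉ p)
∣p∣<∣q∣⇒∃∈q∖p {p = p} {q} ∣p∣<∣q∣ with ⊆⊎∃∈∖ p q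
... | inj₁ q⊆p   = contradiction (p⊆q⇒∣p∣≤∣q∣ q⊆p) (ℕ.<⇒≱ ∣p∣<∣q∣)
... | inj₂ x∈q∖p = x∈q∖p

p⊆q∧∣q∣≤∣p∣⇒p≡q : ∀ {n} {p q : Subset n} → p ⊆ q → ∣ q ∣ ≤ ∣ p ∣ → p ≡ q
p⊆q∧∣q∣≤∣p∣⇒p≡q {p = p} {q} p⊆q ∣q∣≤∣p∣ with ⊆⊎∃∈∖ p q
... | inj₁ q⊆p   = ⊆-antisym p⊆q q⊆p
... | inj₂ x∈q∖p = contradiction (p⊂q⇒∣p∣<∣q∣ (p⊆q , x∈q∖p)) (ℕ.≤⇒≯ ∣q∣≤∣p∣)

2≤∣p∣⇒∃distinct : ∀ {n} {p : Subset n} → 2 ≤ ∣ p ∣ → ∃₂ λ x y → x ≢ y × x ∈ p × y ∈ p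
2≤∣p∣⇒∃distinct {n} {p} 2≤∣p∣
  with x , x∈p , _   ← ∣p∣<∣q∣⇒∃∈q∖p {p = ⊥} (subst (_< ∣ p ∣) (sym (∣⊥∣≡0 n)) (ℕ.≤-trans (s≤s z≤n) 2≤∣p∣))
  with y , y∈p , y∉x ← ∣p∣<∣q∣⇒∃∈q∖p (subst (_< ∣ p ∣) (sym (∣⁅x⁆∣≡1 x)) 2≤∣p∣)
  = x , y , (λ x≡y → y∉x (subst (_∈ ⁅ x ⁆) x≡y (x∈⁅x⁆ x))) , x∈p , y∈p

module _ where
  open MonoidSum ℕ.+-0-commutativeMonoid using (sum; sum-cong-≗; sum-permute)

  private
    𝟙 : Bool → ℕ
    𝟙 b = if b then 1 else 0

  ∣p∣≡∑𝟙[∈p] : ∀ {n} (p : Subset n) → ∣ p ∣ ≡ sum (𝟙 ∘ lookup p)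
  ∣p∣≡∑𝟙[∈p] []            = refl
  ∣p∣≡∑𝟙[∈p] (inside  ∷ p) = cong suc (∣p∣≡∑𝟙[∈p] p)
  ∣p∣≡∑𝟙[∈p] (outside ∷ p) = ∣p∣≡∑𝟙[∈p] p

  ∣p∘π∣≡∣p∣ : ∀ {n} (π : Permutation n n) (p : Subset n) → ∣ tabulate (lookup p ∘ (π ⟨$⟩ʳ_)) ∣ ≡ ∣ p ∣
  ∣p∘π∣≡∣p∣ π p = begin
    ∣ p∘π ∣                         ≡⟨ ∣p∣≡∑𝟙[∈p] p∘π ⟩
    sum (𝟙 ∘ lookup p∘π)            ≡⟨ sum-cong-≗ (cong 𝟙 ∘ lookup∘tabulate (lookup p ∘ (π ⟨$⟩ʳ_))) ⟩
    sum (𝟙 ∘ lookup p ∘ (π ⟨$⟩ʳ_))  ≡⟨ sym (sum-permute (𝟙 ∘ lookup p) π) ⟩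
    sum (𝟙 ∘ lookup p)              ≡⟨ sym (∣p∣≡∑𝟙[∈p] p) ⟩
    ∣ p ∣                           ∎
    where p∘π = tabulate (lookup p ∘ (π ⟨$⟩ʳ_))

module _ {n : ℕ} where

  triple : Fin n → Fin n → Fin n → Subset n
  triple a b c = ⁅ a ⁆ ∪ ⁅ b ⁆ ∪ ⁅ c ⁆

  ∈triple⁻ : ∀ {a b c y} → y ∈ triple a b c → y ≡ a ⊎ y ≡ b ⊎ y ≡ c
  ∈triple⁻ {a} {b} {c} y∈ with x∈p∪q⁻ ⁅ a ⁆ _ y∈
  ... | inj₁ y∈a = inj₁ (x∈⁅y⁆⇒x≡y a y∈a)
  ... | inj₂ y∈bc with x∈p∪q⁻ ⁅ b ⁆ ⁅ c ⁆ y∈bc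
  ...   | inj₁ y∈b = inj₂ (inj₁ (x∈⁅y⁆⇒x≡y b y∈b))
  ...   | inj₂ y∈c = inj₂ (inj₂ (x∈⁅y⁆⇒x≡y c y∈c))

  ∈triple⁺ : ∀ {a b c y} → y ≡ a ⊎ y ≡ b ⊎ y ≡ c → y ∈ triple a b c
  ∈triple⁺ (inj₁ refl)        = x∈p∪q⁺ (inj₁ (x∈⁅x⁆ _))
  ∈triple⁺ (inj₂ (inj₁ refl)) = x∈p∪q⁺ (inj₂ (x∈p∪q⁺ (inj₁ (x∈⁅x⁆ _))))
  ∈triple⁺ (inj₂ (inj₂ refl)) = x∈p∪q⁺ (inj₂ (x∈p∪q⁺ (inj₂ (x∈⁅x⁆ _))))

  triple-rotate : ∀ {a b c} → triple a b c ≡ triple b c a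
  triple-rotate = ⊆-antisym (∈triple⁺ ∘ [ inj₂ ∘ inj₂ , [ inj₁ , inj₂ ∘ inj₁ ]′ ]′ ∘ ∈triple⁻)
                            (∈triple⁺ ∘ [ inj₂ ∘ inj₁ , [ inj₂ ∘ inj₂ , inj₁ ]′ ]′ ∘ ∈triple⁻)

  ∣triple∣≡3 : ∀ {a b c} → a ≢ b → a ≢ c → b ≢ c → ∣ triple a b c ∣ ≡ 3
  ∣triple∣≡3 {a} {b} {c} a≢b a≢c b≢c = begin
    ∣ ⁅ a ⁆ ∪ ⁅ b ⁆ ∪ ⁅ c ⁆ ∣  ≡⟨ ∣⁅x⁆∪p∣≡1+∣p∣ _ a∉bc ⟩
    suc ∣ ⁅ b ⁆ ∪ ⁅ c ⁆ ∣      ≡⟨ cong suc (∣⁅x⁆∪p∣≡1+∣p∣ _ (b≢c ∘ x∈⁅y⁆⇒x≡y c)) ⟩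
    suc (suc ∣ ⁅ c ⁆ ∣)        ≡⟨ cong (suc ∘ suc) (∣⁅x⁆∣≡1 c) ⟩
    3                          ∎
    where
    a∉bc : a ∉ ⁅ b ⁆ ∪ ⁅ c ⁆
    a∉bc a∈ = [ a≢b ∘ x∈⁅y⁆⇒x≡y b , a≢c ∘ x∈⁅y⁆⇒x≡y c ]′ (x∈p∪q⁻ ⁅ b ⁆ ⁅ c ⁆ a∈)

-- Rank-3 paving matroids

PartialLinearSpace : ∀ {n} → (Subset n → Set) → Set
PartialLinearSpace {n} IsLine =
  ∀ {L M : Subset n} {x y} → x ≢ y → IsLine L → IsLine M →
  x ∈ L → y ∈ L → x ∈ M → y ∈ M → L ≡ M

module Rank3PavingMatroid {n : ℕ} {IsLine : Subset n → Set}
  (isLine? : Decidable IsLine) (linear : PartialLinearSpace IsLine) where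

  Indep : Subset n → Set
  Indep A = ∣ A ∣ ≤ 2 ⊎ (∣ A ∣ ≡ 3 × ¬ IsLine A)

  indep⇒∣∣≤3 : ∀ {A} → Indep A → ∣ A ∣ ≤ 3
  indep⇒∣∣≤3 (inj₁ ∣A∣≤2)       = ℕ.m≤n⇒m≤1+n ∣A∣≤2
  indep⇒∣∣≤3 (inj₂ (∣A∣≡3 , _)) = ℕ.≤-reflexive ∣A∣≡3

  indep-subset : ∀ {A B} → A ⊆ B → Indep B → Indep A
  indep-subset A⊆B (inj₁ ∣B∣≤2) = inj₁ (ℕ.≤-trans (p⊆q⇒∣p∣≤∣q∣ A⊆B) ∣B∣≤2)
  indep-subset {A} A⊆B (inj₂ (∣B∣≡3 , ¬lineB)) with ∣ A ∣ ≤? 2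
  ... | yes ∣A∣≤2 = inj₁ ∣A∣≤2
  ... | no  ∣A∣≰2 = inj₂ (trans (cong ∣_∣ A≡B) ∣B∣≡3 , ¬lineB ∘ subst IsLine A≡B)
    where
    A≡B = p⊆q∧∣q∣≤∣p∣⇒p≡q A⊆B (subst (_≤ ∣ A ∣) (sym ∣B∣≡3) (ℕ.≰⇒> ∣A∣≰2))

  extend-small : ∀ {A B} → ∣ A ∣ ≤ 1 → ∣ A ∣ < ∣ B ∣ →
                 ∃[ x ] (x ∈ B × x ∉ A × Indep (A ∪ ⁅ x ⁆))
  extend-small {A} ∣A∣≤1 ∣A∣<∣B∣ with x , x∈B , x∉A ← ∣p∣<∣q∣⇒∃∈q∖p ∣A∣<∣B∣ =
    x , x∈B , x∉A , inj₁ (subst (_≤ 2) (sym (∣p∪⁅x⁆∣≡1+∣p∣ A x∉A)) (s≤s ∣A∣≤1))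

  lines-through-pair : ∀ {A x y} → ∣ A ∣ ≡ 2 →
                       IsLine (A ∪ ⁅ x ⁆) → IsLine (A ∪ ⁅ y ⁆) → A ∪ ⁅ x ⁆ ≡ A ∪ ⁅ y ⁆
  lines-through-pair {A} ∣A∣≡2 lineˣ lineʸ
    with a , b , a≢b , a∈A , b∈A ← 2≤∣p∣⇒∃distinct (ℕ.≤-reflexive (sym ∣A∣≡2)) =
    linear a≢b lineˣ lineʸ (p⊆p∪q _ a∈A) (p⊆p∪q _ b∈A) (p⊆p∪q _ a∈A) (p⊆p∪q _ b∈A)

  extend-pair : ∀ {A B} → ∣ A ∣ ≡ 2 → ∣ B ∣ ≡ 3 → ¬ IsLine B →
                ∃[ x ] (x ∈ B × x ∉ A × Indep (A ∪ ⁅ x ⁆))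
  extend-pair {A} {B} ∣A∣≡2 ∣B∣≡3 ¬lineB
    with x , x∈B , x∉A ← ∣p∣<∣q∣⇒∃∈q∖p (subst₂ _<_ (sym ∣A∣≡2) (sym ∣B∣≡3) ℕ.≤-refl) =
    extend-unless-line x∈B x∉A λ lineˣ →
      let y , y∈B , y∉A∪x = point-off x∉A lineˣ in
      extend-unless-line y∈B (y∉A∪x ∘ p⊆p∪q ⁅ x ⁆) λ lineʸ →
        contradiction (subst (y ∈_) (lines-through-pair ∣A∣≡2 lineʸ lineˣ) (x∈p∪q⁺ (inj₂ (x∈⁅x⁆ y)))) y∉A∪x
    where
    Extension = ∃[ x ] (x ∈ B × x ∉ A × Indep (A ∪ ⁅ x ⁆))

    ∣A∪x∣≡3 : ∀ {x} → x ∉ A → ∣ A ∪ ⁅ x ⁆ ∣ ≡ 3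
    ∣A∪x∣≡3 x∉A = trans (∣p∪⁅x⁆∣≡1+∣p∣ A x∉A) (cong suc ∣A∣≡2)

    extend-unless-line : ∀ {x} → x ∈ B → x ∉ A → (IsLine (A ∪ ⁅ x ⁆) → Extension) → Extension
    extend-unless-line {x} x∈B x∉A k with isLine? (A ∪ ⁅ x ⁆)
    ... | yes line = k line
    ... | no ¬line = x , x∈B , x∉A , inj₂ (∣A∪x∣≡3 x∉A , ¬line)

    point-off : ∀ {x} → x ∉ A → IsLine (A ∪ ⁅ x ⁆) → ∃[ y ] (y ∈ B × y ∉ A ∪ ⁅ x ⁆)
    point-off {x} x∉A line with ⊆⊎∃∈∖ (A ∪ ⁅ x ⁆) B
    ... | inj₂ y∈B∖L = y∈B∖L
    ... | inj₁ B⊆L   = contradiction (subst IsLine (sym B≡L) line) ¬lineB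
      where
      B≡L = p⊆q∧∣q∣≤∣p∣⇒p≡q B⊆L (ℕ.≤-reflexive (trans (∣A∪x∣≡3 x∉A) (sym ∣B∣≡3)))

  -- A itself need not be independent: ∣ A ∣ < ∣ B ∣ ≤ 3 already makes it small enough.
  indep-augment : ∀ {A B} → Indep A → Indep B → ∣ A ∣ < ∣ B ∣ →
                  ∃[ x ] (x ∈ B × x ∉ A × Indep (A ∪ ⁅ x ⁆))
  indep-augment _ (inj₁ ∣B∣≤2) ∣A∣<∣B∣ = extend-small (ℕ.s≤s⁻¹ (ℕ.≤-trans ∣A∣<∣B∣ ∣B∣≤2)) ∣A∣<∣B∣
  indep-augment {A} _ (inj₂ (∣B∣≡3 , ¬lineB)) ∣A∣<∣B∣ with ∣ A ∣ ℕ.≟ 2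
  ... | yes ∣A∣≡2 = extend-pair ∣A∣≡2 ∣B∣≡3 ¬lineB
  ... | no  ∣A∣≢2 = extend-small ∣A∣≤1 ∣A∣<∣B∣
    where
    ∣A∣≤1 = ℕ.s≤s⁻¹ (ℕ.≤∧≢⇒< (ℕ.s≤s⁻¹ (subst (∣ A ∣ <_) ∣B∣≡3 ∣A∣<∣B∣)) ∣A∣≢2)

  matroid : Matroid n
  matroid = record
    { Indep         = Indep
    ; indep-empty   = inj₁ (subst (_≤ 2) (sym (∣⊥∣≡0 n)) z≤n)
    ; indep-subset  = indep-subset
    ; indep-augment = indep-augment
    }

  simple : Simple matroid
  simple C (dependent , _) with ∣ C ∣ ≤? 2
  ... | yes ∣C∣≤2 = contradiction (inj₁ ∣C∣≤2) dependent
  ... | no  ∣C∣≰2 = ℕ.≰⇒> ∣C∣≰2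

  isBasis⇔¬isLine : ∀ {B} → ∣ B ∣ ≡ 3 → IsBasis matroid B ⇔ (¬ IsLine B)
  isBasis⇔¬isLine {B} ∣B∣≡3 = mk⇔ to from
    where
    to : IsBasis matroid B → ¬ IsLine B
    to (inj₁ ∣B∣≤2 , _)        = contradiction (subst (_≤ 2) ∣B∣≡3 ∣B∣≤2) (ℕ.<-irrefl refl)
    to (inj₂ (_ , ¬lineB) , _) = ¬lineB

    from : ¬ IsLine B → IsBasis matroid B
    from ¬lineB = inj₂ (∣B∣≡3 , ¬lineB) , λ x x∉B indep →
      contradiction (indep⇒∣∣≤3 indep) (ℕ.<⇒≱ (ℕ.≤-reflexive (sym (∣B∪x∣≡4 x∉B))))
      where
      ∣B∪x∣≡4 : ∀ {x} → x ∉ B → ∣ B ∪ ⁅ x ⁆ ∣ ≡ 4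
      ∣B∪x∣≡4 x∉B = trans (∣p∪⁅x⁆∣≡1+∣p∣ B x∉B) (cong suc ∣B∣≡3)

  hasRank3 : 4 ≤ n → HasRank matroid 3
  hasRank3 4≤n = independent-triple , λ _ → indep⇒∣∣≤3
    where
    point : Fin 4 → Fin n
    point i = Fin.inject≤ i 4≤n

    point-injective : ∀ i j → i ≢ j → point i ≢ point j
    point-injective i j i≢j = i≢j ∘ inject≤-injective 4≤n 4≤n i j

    witness : ∀ k → k ≢ 0F → k ≢ 1F → ¬ IsLine (triple (point 0F) (point 1F) (point k)) →
                ∃[ B ] (Indep B × ∣ B ∣ ≡ 3)
    witness k k≢0 k≢1 ¬line = _ , inj₂ (∣B∣≡3 , ¬line) , ∣B∣≡3
      where
      ∣B∣≡3 = ∣triple∣≡3 (point-injective 0F 1F λ ())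
                (point-injective 0F k (k≢0 ∘ sym)) (point-injective 1F k (k≢1 ∘ sym))

    -- Two triples sharing two points cannot both be lines.
    independent-triple : ∃[ B ] (Indep B × ∣ B ∣ ≡ 3)
    independent-triple with isLine? (triple (point 0F) (point 1F) (point 2F))
                          | isLine? (triple (point 0F) (point 1F) (point 3F))
    ... | no ¬line  | _         = witness 2F (λ ()) (λ ()) ¬line
    ... | yes _     | no ¬line  = witness 3F (λ ()) (λ ()) ¬line
    ... | yes line₂ | yes line₃ =
      ⊥-elim ([ point-injective 2F 0F (λ ()) , [ point-injective 2F 1F (λ ()) , point-injective 2F 3F (λ ()) ]′ ]′
                (∈triple⁻ (subst (point 2F ∈_) same-line (∈triple⁺ (inj₂ (inj₂ refl))))))
      where
      same-line = linear (point-injective 0F 1F λ ()) line₂ line₃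
        (∈triple⁺ (inj₁ refl)) (∈triple⁺ (inj₂ (inj₁ refl)))
        (∈triple⁺ (inj₁ refl)) (∈triple⁺ (inj₂ (inj₁ refl)))

-- The field ℤ/p

-- The ring laws are transported from ℕ along the surjective semiring homomorphism _mod p.
module _ {p : ℕ} .{{_ : NonZero p}} where

  toℕ-mod : ∀ m → toℕ (m mod p) ≡ m % p
  toℕ-mod m = toℕ-fromℕ< (m%n<n m p)

  mod-toℕ : (x : Fin p) → toℕ x mod p ≡ x
  mod-toℕ x = toℕ-injective (trans (toℕ-mod (toℕ x)) (m<n⇒m%n≡m (toℕ<n x)))

  toℕ-0ₚ : toℕ (0ₚ {p}) ≡ 0
  toℕ-0ₚ = trans (toℕ-mod 0) (m<n⇒m%n≡m (ℕ.>-nonZero⁻¹ p))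

  mod-cong-% : ∀ {m n} → m % p ≡ n % p → m mod p ≡ n mod p
  mod-cong-% {m} {n} eq = toℕ-injective (trans (toℕ-mod m) (trans eq (sym (toℕ-mod n))))

  mod-distrib-+ : ∀ m n → (m ℕ.+ n) mod p ≡ m mod p +ₚ n mod p
  mod-distrib-+ m n = mod-cong-% (begin
    (m ℕ.+ n) % p                          ≡⟨ %-distribˡ-+ m n p ⟩
    (m % p ℕ.+ n % p) % p                  ≡⟨ cong₂ (λ a b → (a ℕ.+ b) % p) (sym (toℕ-mod m)) (sym (toℕ-mod n)) ⟩
    (toℕ (m mod p) ℕ.+ toℕ (n mod p)) % p  ∎)

  mod-distrib-* : ∀ m n → (m ℕ.* n) mod p ≡ (m mod p) *ₚ (n mod p)
  mod-distrib-* m n = mod-cong-% (begin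
    (m ℕ.* n) % p                          ≡⟨ %-distribˡ-* m n p ⟩
    (m % p ℕ.* (n % p)) % p                ≡⟨ cong₂ (λ a b → (a ℕ.* b) % p) (sym (toℕ-mod m)) (sym (toℕ-mod n)) ⟩
    (toℕ (m mod p) ℕ.* toℕ (n mod p)) % p  ∎)

  +ₚ-assoc : ∀ x y z → (x +ₚ y) +ₚ z ≡ x +ₚ (y +ₚ z)
  +ₚ-assoc x y z = begin
    (x +ₚ y) +ₚ z                            ≡⟨ cong ((x +ₚ y) +ₚ_) (sym (mod-toℕ z)) ⟩
    (toℕ x ℕ.+ toℕ y) mod p +ₚ toℕ z mod p  ≡⟨ sym (mod-distrib-+ (toℕ x ℕ.+ toℕ y) (toℕ z)) ⟩
    (toℕ x ℕ.+ toℕ y ℕ.+ toℕ z) mod p       ≡⟨ cong (_mod p) (ℕ.+-assoc (toℕ x) (toℕ y) (toℕ z)) ⟩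
    (toℕ x ℕ.+ (toℕ y ℕ.+ toℕ z)) mod p     ≡⟨ mod-distrib-+ (toℕ x) (toℕ y ℕ.+ toℕ z) ⟩
    toℕ x mod p +ₚ (y +ₚ z)                  ≡⟨ cong (_+ₚ (y +ₚ z)) (mod-toℕ x) ⟩
    x +ₚ (y +ₚ z)                            ∎

  *ₚ-assoc : ∀ x y z → (x *ₚ y) *ₚ z ≡ x *ₚ (y *ₚ z)
  *ₚ-assoc x y z = begin
    (x *ₚ y) *ₚ z                                ≡⟨ cong ((x *ₚ y) *ₚ_) (sym (mod-toℕ z)) ⟩
    ((toℕ x ℕ.* toℕ y) mod p) *ₚ (toℕ z mod p)  ≡⟨ sym (mod-distrib-* (toℕ x ℕ.* toℕ y) (toℕ z)) ⟩
    (toℕ x ℕ.* toℕ y ℕ.* toℕ z) mod p           ≡⟨ cong (_mod p) (ℕ.*-assoc (toℕ x) (toℕ y) (toℕ z)) ⟩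
    (toℕ x ℕ.* (toℕ y ℕ.* toℕ z)) mod p         ≡⟨ mod-distrib-* (toℕ x) (toℕ y ℕ.* toℕ z) ⟩
    (toℕ x mod p) *ₚ (y *ₚ z)                    ≡⟨ cong (_*ₚ (y *ₚ z)) (mod-toℕ x) ⟩
    x *ₚ (y *ₚ z)                                ∎

  +ₚ-comm : ∀ x y → x +ₚ y ≡ y +ₚ x
  +ₚ-comm x y = cong (_mod p) (ℕ.+-comm (toℕ x) (toℕ y))

  *ₚ-comm : ∀ x y → x *ₚ y ≡ y *ₚ x
  *ₚ-comm x y = cong (_mod p) (ℕ.*-comm (toℕ x) (toℕ y))

  +ₚ-identityˡ : ∀ x → 0ₚ +ₚ x ≡ x
  +ₚ-identityˡ x = begin
    0ₚ +ₚ x            ≡⟨ cong (0ₚ +ₚ_) (sym (mod-toℕ x)) ⟩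
    0ₚ +ₚ toℕ x mod p  ≡⟨ sym (mod-distrib-+ 0 (toℕ x)) ⟩
    toℕ x mod p        ≡⟨ mod-toℕ x ⟩
    x                  ∎

  *ₚ-identityˡ : ∀ x → 1ₚ *ₚ x ≡ x
  *ₚ-identityˡ x = begin
    1ₚ *ₚ x               ≡⟨ cong (1ₚ *ₚ_) (sym (mod-toℕ x)) ⟩
    1ₚ *ₚ (toℕ x mod p)   ≡⟨ sym (mod-distrib-* 1 (toℕ x)) ⟩
    (1 ℕ.* toℕ x) mod p   ≡⟨ cong (_mod p) (ℕ.*-identityˡ (toℕ x)) ⟩
    toℕ x mod p           ≡⟨ mod-toℕ x ⟩
    x                     ∎

  -ₚ-inverseˡ : ∀ x → (-ₚ x) +ₚ x ≡ 0ₚ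
  -ₚ-inverseˡ x = begin
    (-ₚ x) +ₚ x                    ≡⟨ cong ((-ₚ x) +ₚ_) (sym (mod-toℕ x)) ⟩
    (-ₚ x) +ₚ toℕ x mod p          ≡⟨ sym (mod-distrib-+ (p ℕ.∸ toℕ x) (toℕ x)) ⟩
    (p ℕ.∸ toℕ x ℕ.+ toℕ x) mod p  ≡⟨ cong (_mod p) (ℕ.m∸n+n≡m (ℕ.<⇒≤ (toℕ<n x))) ⟩
    p mod p                        ≡⟨ toℕ-injective (trans (toℕ-mod p) (trans (n%n≡0 p) (sym toℕ-0ₚ))) ⟩
    0ₚ                             ∎

  *ₚ-distribˡ-+ₚ : ∀ x y z → x *ₚ (y +ₚ z) ≡ x *ₚ y +ₚ x *ₚ z
  *ₚ-distribˡ-+ₚ x y z = begin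
    x *ₚ (y +ₚ z)                                ≡⟨ cong (_*ₚ (y +ₚ z)) (sym (mod-toℕ x)) ⟩
    (toℕ x mod p) *ₚ (y +ₚ z)                    ≡⟨ sym (mod-distrib-* (toℕ x) (toℕ y ℕ.+ toℕ z)) ⟩
    (toℕ x ℕ.* (toℕ y ℕ.+ toℕ z)) mod p          ≡⟨ cong (_mod p) (ℕ.*-distribˡ-+ (toℕ x) (toℕ y) (toℕ z)) ⟩
    (toℕ x ℕ.* toℕ y ℕ.+ toℕ x ℕ.* toℕ z) mod p  ≡⟨ mod-distrib-+ (toℕ x ℕ.* toℕ y) (toℕ x ℕ.* toℕ z) ⟩
    x *ₚ y +ₚ x *ₚ z                             ∎

ℤ/_ : (p : ℕ) .{{_ : NonZero p}} → CommutativeRing 0ℓ 0ℓ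
ℤ/ p = record
  { isCommutativeRing = record
    { isRing = record
      { +-isAbelianGroup = record
        { isGroup = record
          { isMonoid = record
            { isSemigroup = record
              { isMagma = record { isEquivalence = isEquivalence ; ∙-cong = cong₂ _+ₚ_ }
              ; assoc   = +ₚ-assoc
              }
            ; identity = comm∧idˡ⇒id +ₚ-comm {0ₚ} +ₚ-identityˡ
            }
          ; inverse = comm∧invˡ⇒inv +ₚ-comm -ₚ-inverseˡ
          ; ⁻¹-cong = cong (λ x → -ₚ x)
          }
        ; comm = +ₚ-comm
        }
      ; *-cong     = cong₂ _*ₚ_
      ; *-assoc    = *ₚ-assoc
      ; *-identity = comm∧idˡ⇒id *ₚ-comm {1ₚ} *ₚ-identityˡ
      ; distrib    = comm∧distrˡ⇒distr (cong₂ _+ₚ_) *ₚ-comm *ₚ-distribˡ-+ₚ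
      }
    ; *-comm = *ₚ-comm
    }
  }

module _ {p : ℕ} .{{_ : NonZero p}} where
  open import Algebra.Properties.Semiring.Exp (CommutativeRing.semiring (ℤ/ p)) public using (_^_)
  open CommutativeRing (ℤ/ p) using (*-identityˡ)

  1^n≡1 : ∀ n → 1ₚ {p} ^ n ≡ 1ₚ
  1^n≡1 zero    = refl
  1^n≡1 (suc n) = trans (*-identityˡ _) (1^n≡1 n)

  p∣toℕ⇒≡0ₚ : ∀ {x : Fin p} → p ∣ toℕ x → x ≡ 0ₚ
  p∣toℕ⇒≡0ₚ {x} p∣x = toℕ-injective (begin
    toℕ x      ≡⟨ sym (m<n⇒m%n≡m (toℕ<n x)) ⟩
    toℕ x % p  ≡⟨ n∣m⇒m%n≡0 (toℕ x) p p∣x ⟩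
    0          ≡⟨ sym toℕ-0ₚ ⟩
    toℕ 0ₚ     ∎)

module PrimeField {p : ℕ} .{{_ : NonZero p}} (p-prime : Prime p) where
  open CommutativeRing (ℤ/ p) using (commutativeSemiring; zeroʳ)
  open import Algebra.Properties.Ring (CommutativeRing.ring (ℤ/ p))
    using (x[y-z]≈xy-xz; x∙y⁻¹≈ε⇒x≈y; x≈y⇒x∙y⁻¹≈ε)
  open import Algebra.Solver.Ring.NaturalCoefficients.Default commutativeSemiring
    using (solve; _:=_; _:+_; _:*_; con)

  1ₚ≢0ₚ : 1ₚ {p} ≢ 0ₚ
  1ₚ≢0ₚ 1≡0 = ℕ.1+n≢0 (begin
    1       ≡⟨ sym (m<n⇒m%n≡m (ℕ.nonTrivial⇒n>1 p {{prime⇒nonTrivial p-prime}})) ⟩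
    1 % p   ≡⟨ sym (toℕ-mod 1) ⟩
    toℕ 1ₚ  ≡⟨ cong toℕ 1≡0 ⟩
    toℕ 0ₚ  ≡⟨ toℕ-0ₚ ⟩
    0       ∎)

  x*y≡0⇒x≡0⊎y≡0 : ∀ {x y : Fin p} → x *ₚ y ≡ 0ₚ → x ≡ 0ₚ ⊎ y ≡ 0ₚ
  x*y≡0⇒x≡0⊎y≡0 {x} {y} xy≡0 =
    Sum.map p∣toℕ⇒≡0ₚ p∣toℕ⇒≡0ₚ (euclidsLemma (toℕ x) (toℕ y) p-prime p∣xy)
    where
    p∣xy : p ∣ toℕ x ℕ.* toℕ y
    p∣xy = m%n≡0⇒n∣m _ p (trans (sym (toℕ-mod _)) (trans (cong toℕ xy≡0) toℕ-0ₚ))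

  *ₚ-nonzero : ∀ {x y : Fin p} → x ≢ 0ₚ → y ≢ 0ₚ → x *ₚ y ≢ 0ₚ
  *ₚ-nonzero x≢0 y≢0 = [ x≢0 , y≢0 ]′ ∘ x*y≡0⇒x≡0⊎y≡0

  *ₚ-cancelˡ : ∀ {x y z : Fin p} → x ≢ 0ₚ → x *ₚ y ≡ x *ₚ z → y ≡ z
  *ₚ-cancelˡ {x} {y} {z} x≢0 xy≡xz =
    x∙y⁻¹≈ε⇒x≈y y z ([ (λ x≡0 → contradiction x≡0 x≢0) , id ]′ (x*y≡0⇒x≡0⊎y≡0 x[y-z]≡0))
    where
    x[y-z]≡0 : x *ₚ (y -ₚ z) ≡ 0ₚ
    x[y-z]≡0 = trans (x[y-z]≈xy-xz x y z) (x≈y⇒x∙y⁻¹≈ε xy≡xz)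

  *ₚ-inverse : ∀ {x : Fin p} → x ≢ 0ₚ → ∃[ y ] x *ₚ y ≡ 1ₚ
  *ₚ-inverse x≢0 = injective⇒surjective (*ₚ-cancelˡ x≢0) 1ₚ

  x*x≡1⇒x≡1⊎x+1≡0 : ∀ {x : Fin p} → x *ₚ x ≡ 1ₚ → x ≡ 1ₚ ⊎ x +ₚ 1ₚ ≡ 0ₚ
  x*x≡1⇒x≡1⊎x+1≡0 {x} x*x≡1 with x +ₚ 1ₚ ≟ 0ₚ
  ... | yes x+1≡0 = inj₂ x+1≡0
  ... | no  x+1≢0 = inj₁ (*ₚ-cancelˡ x+1≢0 (begin
    (x +ₚ 1ₚ) *ₚ x   ≡⟨ solve 1 (λ x → (x :+ con 1) :* x := x :* x :+ x) refl x ⟩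
    x *ₚ x +ₚ x      ≡⟨ cong (_+ₚ x) x*x≡1 ⟩
    1ₚ +ₚ x          ≡⟨ solve 1 (λ x → con 1 :+ x := (x :+ con 1) :* con 1) refl x ⟩
    (x +ₚ 1ₚ) *ₚ 1ₚ  ∎))

module FermatLittle {n : ℕ} (p-prime : Prime (suc n)) where
  open PrimeField p-prime
  open CommutativeRing (ℤ/ suc n)
    using (*-commutativeMonoid; *-comm; *-assoc; *-identityˡ; *-identityʳ; zeroʳ)
  open MonoidSum *-commutativeMonoid
    using () renaming (sum to ∏; sum-cong-≗ to ∏-cong; sum-replicate to ∏-replicate;
                       ∑-distrib-+ to ∏-distrib-*; sum-permute to ∏-permute)

  -- Multiplication by a ≠ 0 permutes ℤ/p and fixes 0; replacing 0 by 1 turns the product over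
  -- all of ℤ/p into the product of the units, which is therefore unchanged by that permutation.
  0↦1 : Fin (suc n) → Fin (suc n)
  0↦1 Fin.zero    = 1ₚ
  0↦1 (Fin.suc j) = Fin.suc j

  0↦1-nonzero : ∀ {x} → x ≢ 0ₚ → 0↦1 x ≡ x
  0↦1-nonzero {Fin.zero}  0≢0 = contradiction refl 0≢0
  0↦1-nonzero {Fin.suc _} _   = refl

  ∏-nonzero : ∀ {m} (f : Fin m → Fin (suc n)) → (∀ i → f i ≢ 0ₚ) → ∏ f ≢ 0ₚ
  ∏-nonzero {zero}  f _   = 1ₚ≢0ₚ
  ∏-nonzero {suc m} f f≢0 = *ₚ-nonzero (f≢0 Fin.zero) (∏-nonzero (f ∘ Fin.suc) (f≢0 ∘ Fin.suc))

  ∏-0↦1 : ∀ (f : Fin (suc n) → Fin (suc n)) → f 0ₚ ≡ 0ₚ → (∀ j → f (Fin.suc j) ≢ 0ₚ) →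
          ∏ (0↦1 ∘ f) ≡ ∏ (f ∘ Fin.suc)
  ∏-0↦1 f f0≡0 f≢0 = begin
    0↦1 (f 0ₚ) *ₚ ∏ (0↦1 ∘ f ∘ Fin.suc)  ≡⟨ cong₂ _*ₚ_ (cong 0↦1 f0≡0) (∏-cong (0↦1-nonzero ∘ f≢0)) ⟩
    1ₚ *ₚ ∏ (f ∘ Fin.suc)                 ≡⟨ *-identityˡ _ ⟩
    ∏ (f ∘ Fin.suc)                       ∎

  *ₚ-permutation : ∀ {a : Fin (suc n)} → a ≢ 0ₚ → Permutation (suc n) (suc n)
  *ₚ-permutation {a} a≢0 with b , ab≡1 ← *ₚ-inverse a≢0 =
    permutation (a *ₚ_) (b *ₚ_) (cancel {a} {b} ab≡1) (cancel {b} {a} (trans (*-comm b a) ab≡1))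
    where
    cancel : ∀ {x y} → x *ₚ y ≡ 1ₚ → ∀ z → x *ₚ (y *ₚ z) ≡ z
    cancel {x} {y} xy≡1 z = trans (sym (*-assoc x y z)) (trans (cong (_*ₚ z) xy≡1) (*-identityˡ z))

  a^n≡1 : ∀ (a : Fin (suc n)) → a ≢ 0ₚ → a ^ n ≡ 1ₚ
  a^n≡1 a a≢0 = *ₚ-cancelˡ Q≢0 (begin
    Q *ₚ a ^ n                ≡⟨ *-comm Q (a ^ n) ⟩
    a ^ n *ₚ Q                ≡⟨ cong (_*ₚ Q) (sym (∏-replicate n {a})) ⟩
    ∏ {n} (λ _ → a) *ₚ Q      ≡⟨ sym (∏-distrib-* (λ _ → a) Fin.suc) ⟩
    ∏ (λ j → a *ₚ Fin.suc j)  ≡⟨ sym (∏-0↦1 (a *ₚ_) (zeroʳ a) (λ _ → *ₚ-nonzero a≢0 λ ())) ⟩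
    ∏ (0↦1 ∘ (a *ₚ_))         ≡⟨ sym (∏-permute 0↦1 (*ₚ-permutation a≢0)) ⟩
    ∏ 0↦1                     ≡⟨ ∏-0↦1 id refl (λ _ ()) ⟩
    Q                         ≡⟨ sym (*-identityʳ Q) ⟩
    Q *ₚ 1ₚ                   ∎)
    where
    Q = ∏ Fin.suc
    Q≢0 = ∏-nonzero Fin.suc (λ _ ())

fermat : ∀ {p} .{{_ : NonZero p}} → Prime p → (a : Fin p) → a ≢ 0ₚ → a ^ (p ℕ.∸ 1) ≡ 1ₚ
fermat {suc n} p-prime = FermatLittle.a^n≡1 p-prime

-- Primitive sixth roots of unity

-- PrimitiveSixthRoot is phrased with _^ₚ_, which agrees definitionally with _^_ on numerals.
module SixthRoot {p : ℕ} .{{_ : NonZero p}} (p-prime : Prime p)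
                 {u : Fin p} (u-prim : PrimitiveSixthRoot u) where
  open PrimeField p-prime
  open CommutativeRing (ℤ/ p) using (commutativeSemiring; semiring; +-comm; +-identityˡ; *-identityʳ; zeroˡ)
  open import Algebra.Properties.Ring (CommutativeRing.ring (ℤ/ p)) using (+-cancelʳ)
  open import Algebra.Properties.Semiring.Exp semiring using (^-homo-*; ^-assocʳ)
  open import Algebra.Properties.CommutativeSemiring.Exp commutativeSemiring using (^-distrib-*)
  open import Algebra.Solver.Ring.NaturalCoefficients.Default commutativeSemiring
    using (solve; _:=_; _:+_; _:*_; con)

  u²≢1 : u ^ 2 ≢ 1ₚ
  u²≢1 = proj₂ u-prim 2 (s≤s z≤n) (s≤s (s≤s (s≤s z≤n)))

  u³≢1 : u ^ 3 ≢ 1ₚ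
  u³≢1 = proj₂ u-prim 3 (s≤s z≤n) (s≤s (s≤s (s≤s (s≤s z≤n))))

  u≢0 : u ≢ 0ₚ
  u≢0 u≡0 = 1ₚ≢0ₚ (begin
    1ₚ           ≡⟨ sym (proj₁ u-prim) ⟩
    u *ₚ u ^ 5   ≡⟨ cong (_*ₚ u ^ 5) u≡0 ⟩
    0ₚ *ₚ u ^ 5  ≡⟨ zeroˡ _ ⟩
    0ₚ           ∎)

  u³+1≡0 : u ^ 3 +ₚ 1ₚ ≡ 0ₚ
  u³+1≡0 with x*x≡1⇒x≡1⊎x+1≡0 (trans (sym (^-homo-* u 3 3)) (proj₁ u-prim))
  ... | inj₁ u³≡1   = contradiction u³≡1 u³≢1
  ... | inj₂ u³+1≡0 = u³+1≡0

  u+1≢0 : u +ₚ 1ₚ ≢ 0ₚ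
  u+1≢0 u+1≡0 = u²≢1 (+-cancelʳ u _ _ (begin
    u ^ 2 +ₚ u      ≡⟨ solve 1 (λ u → u :* (u :* con 1) :+ u := (u :+ con 1) :* u) refl u ⟩
    (u +ₚ 1ₚ) *ₚ u  ≡⟨ cong (_*ₚ u) u+1≡0 ⟩
    0ₚ *ₚ u         ≡⟨ zeroˡ u ⟩
    0ₚ              ≡⟨ sym u+1≡0 ⟩
    u +ₚ 1ₚ         ≡⟨ +-comm u 1ₚ ⟩
    1ₚ +ₚ u         ∎))

  u²+1≡u : u *ₚ u +ₚ 1ₚ ≡ u
  u²+1≡u = *ₚ-cancelˡ u+1≢0 (begin
    (u +ₚ 1ₚ) *ₚ (u *ₚ u +ₚ 1ₚ)      ≡⟨ solve 1 (λ u → (u :+ con 1) :* (u :* u :+ con 1)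
                                              := (u :* (u :* (u :* con 1)) :+ con 1) :+ (u :+ con 1) :* u) refl u ⟩
    (u ^ 3 +ₚ 1ₚ) +ₚ (u +ₚ 1ₚ) *ₚ u  ≡⟨ cong (_+ₚ (u +ₚ 1ₚ) *ₚ u) u³+1≡0 ⟩
    0ₚ +ₚ (u +ₚ 1ₚ) *ₚ u             ≡⟨ +-identityˡ _ ⟩
    (u +ₚ 1ₚ) *ₚ u                   ∎)

  module _ (p≡7 : p % 12 ≡ 7) where

    -- h = (p - 1) / 2, an odd multiple of 3 since p ≡ 7 (mod 12).
    h : ℕ
    h = 3 ℕ.+ 6 ℕ.* (p / 12)

    p∸1≡2h : p ℕ.∸ 1 ≡ 2 ℕ.* h
    p∸1≡2h = trans (cong (ℕ._∸ 1) p≡7+q*12) (arith (p / 12))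
      where
      p≡7+q*12 : p ≡ 7 ℕ.+ p / 12 ℕ.* 12
      p≡7+q*12 = trans (m≡m%n+[m/n]*n p 12) (cong (ℕ._+ p / 12 ℕ.* 12) p≡7)
      arith : ∀ q → 6 ℕ.+ q ℕ.* 12 ≡ 2 ℕ.* (3 ℕ.+ 6 ℕ.* q)
      arith = solve-∀

    [x*x]^h≡1 : ∀ {x : Fin p} → x ≢ 0ₚ → (x *ₚ x) ^ h ≡ 1ₚ
    [x*x]^h≡1 {x} x≢0 = begin
      (x *ₚ x) ^ h   ≡⟨ cong (λ y → (x *ₚ y) ^ h) (sym (*-identityʳ x)) ⟩
      (x ^ 2) ^ h    ≡⟨ ^-assocʳ x 2 h ⟩
      x ^ (2 ℕ.* h)  ≡⟨ cong (x ^_) (sym p∸1≡2h) ⟩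
      x ^ (p ℕ.∸ 1)  ≡⟨ fermat p-prime x x≢0 ⟩
      1ₚ             ∎

    u^h≡u³ : u ^ h ≡ u ^ 3
    u^h≡u³ = begin
      u ^ (3 ℕ.+ 6 ℕ.* q)     ≡⟨ ^-homo-* u 3 (6 ℕ.* q) ⟩
      u ^ 3 *ₚ u ^ (6 ℕ.* q)  ≡⟨ cong (u ^ 3 *ₚ_) (sym (^-assocʳ u 6 q)) ⟩
      u ^ 3 *ₚ (u ^ 6) ^ q    ≡⟨ cong (λ y → u ^ 3 *ₚ y ^ q) (proj₁ u-prim) ⟩
      u ^ 3 *ₚ 1ₚ ^ q         ≡⟨ cong (u ^ 3 *ₚ_) (1^n≡1 q) ⟩
      u ^ 3 *ₚ 1ₚ             ≡⟨ *-identityʳ _ ⟩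
      u ^ 3                   ∎
      where q = p / 12

    x*x≢u*y*y : ∀ {x y : Fin p} → y ≢ 0ₚ → x *ₚ x ≢ u *ₚ (y *ₚ y)
    x*x≢u*y*y {x} {y} y≢0 x*x≡u*y*y = u³≢1 (begin
      u ^ 3                  ≡⟨ sym u^h≡u³ ⟩
      u ^ h                  ≡⟨ sym (*-identityʳ _) ⟩
      u ^ h *ₚ 1ₚ            ≡⟨ cong (u ^ h *ₚ_) (sym ([x*x]^h≡1 y≢0)) ⟩
      u ^ h *ₚ (y *ₚ y) ^ h  ≡⟨ sym (^-distrib-* u (y *ₚ y) h) ⟩
      (u *ₚ (y *ₚ y)) ^ h    ≡⟨ cong (_^ h) (sym x*x≡u*y*y) ⟩
      (x *ₚ x) ^ h           ≡⟨ [x*x]^h≡1 x≢0 ⟩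
      1ₚ                     ∎)
      where
      x≢0 : x ≢ 0ₚ
      x≢0 x≡0 = *ₚ-nonzero u≢0 (*ₚ-nonzero y≢0 y≢0) (begin
        u *ₚ (y *ₚ y)  ≡⟨ sym x*x≡u*y*y ⟩
        x *ₚ x         ≡⟨ cong (_*ₚ x) x≡0 ⟩
        0ₚ *ₚ x        ≡⟨ zeroˡ x ⟩
        0ₚ             ∎)

-- Translations

module _ {p : ℕ} .{{_ : NonZero p}} where
  open CommutativeRing (ℤ/ p) using (+-assoc; +-identityʳ; -‿inverseˡ; -‿inverseʳ)
  open import Algebra.Properties.Ring (CommutativeRing.ring (ℤ/ p)) using (-‿involutive)

  [x-t]+t≡x : ∀ (x t : Fin p) → (x -ₚ t) +ₚ t ≡ x
  [x-t]+t≡x x t = trans (+-assoc x (-ₚ t) t) (trans (cong (x +ₚ_) (-‿inverseˡ t)) (+-identityʳ x))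

  [x+t]-t≡x : ∀ (x t : Fin p) → (x +ₚ t) -ₚ t ≡ x
  [x+t]-t≡x x t = trans (+-assoc x t (-ₚ t)) (trans (cong (x +ₚ_) (-‿inverseʳ t)) (+-identityʳ x))

  ∈translate⁻ : ∀ {t A y} → y ∈ translate t A → y -ₚ t ∈ A
  ∈translate⁻ {t} {A} {y} y∈ =
    lookup⇒[]= (y -ₚ t) A (trans (sym (lookup∘tabulate (λ z → lookup A (z -ₚ t)) y)) ([]=⇒lookup y∈))

  ∈translate⁺ : ∀ {t A y} → y -ₚ t ∈ A → y ∈ translate t A
  ∈translate⁺ {t} {A} {y} y-t∈ =
    lookup⇒[]= y (translate t A) (trans (lookup∘tabulate (λ z → lookup A (z -ₚ t)) y) ([]=⇒lookup y-t∈))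

  translate-triple : ∀ t a b c → translate t (triple a b c) ≡ triple (a +ₚ t) (b +ₚ t) (c +ₚ t)
  translate-triple t _ _ _ =
    ⊆-antisym (∈triple⁺ ∘ Sum.map shift (Sum.map shift shift) ∘ ∈triple⁻ ∘ ∈translate⁻ {t})
              (∈translate⁺ {t} ∘ ∈triple⁺ ∘ Sum.map unshift (Sum.map unshift unshift) ∘ ∈triple⁻)
    where
    shift : ∀ {y z} → y -ₚ t ≡ z → y ≡ z +ₚ t
    shift {y} refl = sym ([x-t]+t≡x y t)

    unshift : ∀ {y z} → y ≡ z +ₚ t → y -ₚ t ≡ z
    unshift {z = z} refl = [x+t]-t≡x z t

  translate-inverse : ∀ t A → translate (-ₚ t) (translate t A) ≡ A
  translate-inverse t A = trans (tabulate-cong lookup-shifted) (tabulate∘lookup A)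
    where
    lookup-shifted : ∀ y → lookup (translate t A) (y -ₚ (-ₚ t)) ≡ lookup A y
    lookup-shifted y = begin
      lookup (translate t A) (y -ₚ (-ₚ t))  ≡⟨ lookup∘tabulate (λ z → lookup A (z -ₚ t)) _ ⟩
      lookup A ((y -ₚ (-ₚ t)) -ₚ t)         ≡⟨ cong (λ z → lookup A ((y +ₚ z) -ₚ t)) (-‿involutive t) ⟩
      lookup A ((y +ₚ t) -ₚ t)              ≡⟨ cong (lookup A) ([x+t]-t≡x y t) ⟩
      lookup A y                            ∎

  ∣translate∣≡∣∣ : ∀ t A → ∣ translate t A ∣ ≡ ∣ A ∣
  ∣translate∣≡∣∣ t = ∣p∘π∣≡∣p∣ (permutation (_-ₚ t) (_+ₚ t) (λ y → [x+t]-t≡x y t) (λ y → [x-t]+t≡x y t))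

  module _ {IsLine : Subset p → Set} (isLine? : Decidable IsLine)
           (linear : PartialLinearSpace IsLine) where
    open Rank3PavingMatroid isLine? linear

    translationInvariant : (∀ t {A} → IsLine A → IsLine (translate t A)) → TranslationInvariant matroid
    translationInvariant translate-line t A = indep⇒indep-translate , indep-translate⇒indep
      where
      indep⇒indep-translate : Indep A → Indep (translate t A)
      indep⇒indep-translate (inj₁ ∣A∣≤2) = inj₁ (subst (_≤ 2) (sym (∣translate∣≡∣∣ t A)) ∣A∣≤2)
      indep⇒indep-translate (inj₂ (∣A∣≡3 , ¬lineA)) = inj₂ (trans (∣translate∣≡∣∣ t A) ∣A∣≡3 ,
        λ line → ¬lineA (subst IsLine (translate-inverse t A) (translate-line (-ₚ t) line)))

      indep-translate⇒indep : Indep (translate t A) → Indep A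
      indep-translate⇒indep (inj₁ ∣tA∣≤2) = inj₁ (subst (_≤ 2) (∣translate∣≡∣∣ t A) ∣tA∣≤2)
      indep-translate⇒indep (inj₂ (∣tA∣≡3 , ¬line)) =
        inj₂ (trans (sym (∣translate∣≡∣∣ t A)) ∣tA∣≡3 , ¬line ∘ translate-line t)

-- Special triples

-- SpecialTriple u B unfolds to ∃ x α, α ≢ 0ₚ × B ≡ line u x α.
module _ {p : ℕ} .{{_ : NonZero p}} (u : Fin p) where
  open CommutativeRing (ℤ/ p) using (+-commutativeSemigroup)
  open import Algebra.Properties.CommutativeSemigroup +-commutativeSemigroup using (xy∙z≈xz∙y)

  line : Fin p → Fin p → Subset p
  line x α = triple x (x +ₚ α *ₚ α) (x +ₚ u *ₚ (α *ₚ α))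

  line-cong : ∀ x α β → α *ₚ α ≡ β *ₚ β → line x α ≡ line x β
  line-cong x _ _ = cong (λ q → triple x (x +ₚ q) (x +ₚ u *ₚ q))

  translate-line : ∀ t x α → translate t (line x α) ≡ line (x +ₚ t) α
  translate-line t x α = trans (translate-triple t _ _ _)
    (cong₂ (triple (x +ₚ t)) (xy∙z≈xz∙y x (α *ₚ α) t) (xy∙z≈xz∙y x (u *ₚ (α *ₚ α)) t))

  specialTriple-translate : ∀ t {A} → SpecialTriple u A → SpecialTriple u (translate t A)
  specialTriple-translate t (x , α , α≢0 , refl) = x +ₚ t , α , α≢0 , translate-line t x α

  specialTriple? : Decidable (SpecialTriple u)
  specialTriple? B = any? λ x → any? λ α → ¬? (α ≟ 0ₚ) ×-dec ≡-dec Bool._≟_ B (line x α)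

module SpecialTriples {p : ℕ} .{{_ : NonZero p}} (p-prime : Prime p)
                      {u : Fin p} (u-prim : PrimitiveSixthRoot u) where
  open PrimeField p-prime
  open SixthRoot p-prime u-prim
  open CommutativeRing (ℤ/ p) using (commutativeSemiring; +-identityʳ; zeroˡ)
  open import Algebra.Properties.Ring (CommutativeRing.ring (ℤ/ p)) using (+-cancelˡ)
  open import Algebra.Solver.Ring.NaturalCoefficients.Default commutativeSemiring
    using (solve; _:=_; _:+_; _:*_; con)

  [x+α²]+[uα]²≡x+uα² : ∀ x α → (x +ₚ α *ₚ α) +ₚ (u *ₚ α) *ₚ (u *ₚ α) ≡ x +ₚ u *ₚ (α *ₚ α)
  [x+α²]+[uα]²≡x+uα² x α = begin
    (x +ₚ α *ₚ α) +ₚ (u *ₚ α) *ₚ (u *ₚ α)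
      ≡⟨ solve 3 (λ x α u → (x :+ α :* α) :+ (u :* α) :* (u :* α)
                            := x :+ (u :* u :+ con 1) :* (α :* α)) refl x α u ⟩
    x +ₚ (u *ₚ u +ₚ 1ₚ) *ₚ (α *ₚ α)
      ≡⟨ cong (λ c → x +ₚ c *ₚ (α *ₚ α)) u²+1≡u ⟩
    x +ₚ u *ₚ (α *ₚ α)
      ∎

  [x+α²]+u[uα]²≡x : ∀ x α → (x +ₚ α *ₚ α) +ₚ u *ₚ ((u *ₚ α) *ₚ (u *ₚ α)) ≡ x
  [x+α²]+u[uα]²≡x x α = begin
    (x +ₚ α *ₚ α) +ₚ u *ₚ ((u *ₚ α) *ₚ (u *ₚ α))
      ≡⟨ solve 3 (λ x α u → (x :+ α :* α) :+ u :* ((u :* α) :* (u :* α))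
                            := x :+ (u :* (u :* (u :* con 1)) :+ con 1) :* (α :* α)) refl x α u ⟩
    x +ₚ (u ^ 3 +ₚ 1ₚ) *ₚ (α *ₚ α)
      ≡⟨ cong (λ c → x +ₚ c *ₚ (α *ₚ α)) u³+1≡0 ⟩
    x +ₚ 0ₚ *ₚ (α *ₚ α)
      ≡⟨ cong (x +ₚ_) (zeroˡ (α *ₚ α)) ⟩
    x +ₚ 0ₚ
      ≡⟨ +-identityʳ x ⟩
    x
      ∎

  line-rotate : ∀ x α → line u x α ≡ line u (x +ₚ α *ₚ α) (u *ₚ α)
  line-rotate x α = trans triple-rotate
    (sym (cong₂ (triple (x +ₚ α *ₚ α)) ([x+α²]+[uα]²≡x+uα² x α) ([x+α²]+u[uα]²≡x x α)))

  line-through : ∀ {x α a} → α ≢ 0ₚ → a ∈ line u x α → ∃[ β ] (β ≢ 0ₚ × line u x α ≡ line u a β)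
  line-through {x} {α} α≢0 a∈ with ∈triple⁻ a∈
  ... | inj₁ refl        = α , α≢0 , refl
  ... | inj₂ (inj₁ refl) = u *ₚ α , *ₚ-nonzero u≢0 α≢0 , line-rotate x α
  ... | inj₂ (inj₂ refl) = u *ₚ (u *ₚ α) , *ₚ-nonzero u≢0 (*ₚ-nonzero u≢0 α≢0) , (begin
    line u x α                                                      ≡⟨ line-rotate x α ⟩
    line u (x +ₚ α *ₚ α) (u *ₚ α)                                   ≡⟨ line-rotate _ (u *ₚ α) ⟩
    line u ((x +ₚ α *ₚ α) +ₚ (u *ₚ α) *ₚ (u *ₚ α)) (u *ₚ (u *ₚ α))  ≡⟨ cong (λ y → line u y (u *ₚ (u *ₚ α)))
                                                                           ([x+α²]+[uα]²≡x+uα² x α) ⟩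
    line u (x +ₚ u *ₚ (α *ₚ α)) (u *ₚ (u *ₚ α))                     ∎)

  module _ (p≡7 : p % 12 ≡ 7) where

    line-through-two-points-unique : ∀ {a b α β} → a ≢ b → α ≢ 0ₚ → β ≢ 0ₚ →
                                     b ∈ line u a α → b ∈ line u a β → line u a α ≡ line u a β
    line-through-two-points-unique {a} {b} {α} {β} a≢b α≢0 β≢0 b∈α b∈β with ∈triple⁻ b∈α | ∈triple⁻ b∈β
    ... | inj₁ b≡a | _        = contradiction (sym b≡a) a≢b
    ... | inj₂ _   | inj₁ b≡a = contradiction (sym b≡a) a≢b
    ... | inj₂ (inj₁ b≡a+α²) | inj₂ (inj₁ b≡a+β²) =
      line-cong u a α β (+-cancelˡ a _ _ (trans (sym b≡a+α²) b≡a+β²))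
    ... | inj₂ (inj₂ b≡a+uα²) | inj₂ (inj₂ b≡a+uβ²) =
      line-cong u a α β (*ₚ-cancelˡ u≢0 (+-cancelˡ a _ _ (trans (sym b≡a+uα²) b≡a+uβ²)))
    ... | inj₂ (inj₁ b≡a+α²) | inj₂ (inj₂ b≡a+uβ²) =
      ⊥-elim (x*x≢u*y*y p≡7 {α} β≢0 (+-cancelˡ a _ _ (trans (sym b≡a+α²) b≡a+uβ²)))
    ... | inj₂ (inj₂ b≡a+uα²) | inj₂ (inj₁ b≡a+β²) =
      ⊥-elim (x*x≢u*y*y p≡7 {β} α≢0 (+-cancelˡ a _ _ (trans (sym b≡a+β²) b≡a+uα²)))

    specialTriples-linear : PartialLinearSpace (SpecialTriple u)
    specialTriples-linear a≢b (_ , α , α≢0 , refl) (_ , β , β≢0 , refl) a∈L b∈L a∈M b∈M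
      with α′ , α′≢0 , L≡ ← line-through α≢0 a∈L
         | β′ , β′≢0 , M≡ ← line-through β≢0 a∈M
      = trans L≡ (trans (line-through-two-points-unique a≢b α′≢0 β′≢0 b∈L′ b∈M′) (sym M≡))
      where
      b∈L′ = subst (_ ∈_) L≡ b∈L
      b∈M′ = subst (_ ∈_) M≡ b∈M

proposition3p13 : (p : ℕ) .{{_ : NonZero p}} → Prime p → p % 12 ≡ 7 →
    (u : Fin p) → PrimitiveSixthRoot u →
    ∃[ M ] (HasRank {p} M 3 × Simple M × TranslationInvariant M ×
      (∀ (B : Subset p) → ∣ B ∣ ≡ 3 → (IsBasis M B ⇔ (¬ SpecialTriple u B))))
proposition3p13 p p-prime p≡7 u u-prim =
  matroid , hasRank3 4≤p , simple ,
  translationInvariant (specialTriple? u) linear (specialTriple-translate u) ,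
  λ _ → isBasis⇔¬isLine
  where
  linear : PartialLinearSpace (SpecialTriple u)
  linear = SpecialTriples.specialTriples-linear p-prime u-prim p≡7

  open Rank3PavingMatroid (specialTriple? u) linear

  4≤p : 4 ≤ p
  4≤p = ℕ.≤-trans (s≤s (s≤s (s≤s (s≤s z≤n)))) (subst (_≤ p) p≡7 (m%n≤m p 12))
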